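{- Let $G$ be a finite simple $d$-regular graph. Then $\omega(\mathrm{HL}'_2(G))=d$, where $\omega$ denotes the clique number.
   Context: Symmetric lift: for a finite simple undirected graph $G=(V,E)$, let $B_{\mathrm{HL}'}(G)$ be the bipartite graph with vertex set $V'\sqcup V''$ (two disjoint copies of $V$) having, for each edge $\{u,v\}\in E$, the two edges $u'v''$ and $v'u''$. The symmetric lift is $\mathrm{HL}'_2(G)=L(B_{\mathrm{HL}'}(G))$; equivalently its vertices are ordered pairs $(u,v)$ with $\{u,v\}\in E$, and distinct $(u,v),(x,y)$ are adjacent iff $u=x$ or $v=y$. -}

module Defs where

open import Data.Nat using (ℕ; _≤_)
open import Data.Fin using (Fin)
open import Data.Product using (_×_; _,_; proj₁; proj₂; Σ; ∃)
open import Data.Sum using (_⊎_)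
open import Data.List using (List; length; filter)
open import Data.List.Relation.Unary.All using (All)
open import Data.List.Relation.Unary.AllPairs using (AllPairs)
open import Data.List.Relation.Unary.Unique.Propositional using (Unique)
open import Data.List.Membership.Propositional using (_∈_)
open import Relation.Nullary using (¬_)
open import Relation.Binary using (Decidable)
open import Relation.Binary.PropositionalEquality using (_≡_)
open import Data.Fin.Base using () 
open import Data.List using (allFin)

record Graph (n : ℕ) : Set₁ where
  field
    Adj     : Fin n → Fin n → Set
    adj?    : Decidable Adj
    sym     : ∀ {u v} → Adj u v → Adj v u
    irrefl  : ∀ {u} → ¬ Adj u u
open Graph public

degree : ∀ {n} → Graph n → Fin n → ℕ
degree {n} G v = length (filter (adj? G v) (allFin n))

Regular : ∀ {n} → Graph n → ℕ → Set
Regular {n} G d = ∀ (v : Fin n) → degree G v ≡ d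

IsClique : {V : Set} → (V → V → Set) → List V → Set
IsClique Adj' K = Unique K × AllPairs Adj' K

CliqueNumberIs : (V : Set) → (V → V → Set) → ℕ → Set
CliqueNumberIs V Adj' k =
  (∃ λ (K : List V) → IsClique Adj' K × length K ≡ k)
  × (∀ (K : List V) → IsClique Adj' K → length K ≤ k)

-- Symmetric lift HL'_2(G): vertices are ordered pairs (u,v) with {u,v} ∈ E;
-- distinct (u,v),(x,y) are adjacent iff u = x or v = y.
HLVertex : ∀ {n} → Graph n → Set
HLVertex {n} G = Σ (Fin n × Fin n) (λ p → Adj G (proj₁ p) (proj₂ p))

HLAdj : ∀ {n} (G : Graph n) → HLVertex G → HLVertex G → Set
HLAdj G ((u , v) , _) ((x , y) , _) =
  ¬ ((u , v) ≡ (x , y)) × (u ≡ x ⊎ v ≡ y)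

-- HL'₂(G) is the subgraph of the rook's graph on Fin n × Fin n induced by the
-- directed edges of G. A set of pairwise collinear cells lies in a single row or a
-- single column, so a clique is a set of edges (u , v) sharing u, or sharing v, and
-- its size is bounded by a degree. Conversely, the out-star of any vertex is a clique
-- of size d.
module Submission where

open import Defs
open import Data.Nat using (ℕ; suc; _≤_; z≤n)
open import Data.Nat.Properties using (≤-trans; ≤-reflexive; module ≤-Reasoning)
open import Data.Fin using (Fin; zero; suc)
open import Data.Fin.Properties using (_≟_; injective⇒≤)
open import Data.Product using (_×_; _,_; proj₁; proj₂; swap)
open import Data.Sum as Sum using (_⊎_; inj₁; inj₂)
open import Data.List using (List; []; _∷_; length; lookup; map; filter; allFin)
open import Data.List.Properties using (length-map; map-∘; map-id-local)
open import Data.List.Relation.Unary.All as All using (All; []; _∷_)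
open import Data.List.Relation.Unary.All.Properties as Allₚ using (¬All⇒Any¬; all-filter)
open import Data.List.Relation.Unary.AllPairs as AllPairs using (AllPairs; []; _∷_)
import Data.List.Relation.Unary.AllPairs.Properties as AllPairsₚ
open import Data.List.Relation.Unary.Any using (here; index)
open import Data.List.Relation.Unary.Any.Properties using (lookup-index)
open import Data.List.Relation.Unary.Unique.Propositional using (Unique)
import Data.List.Relation.Unary.Unique.Propositional.Properties as Uniqueₚ
open import Data.List.Relation.Binary.Subset.Propositional using (_⊆_)
open import Data.List.Membership.Propositional using (_∈_; find)
open import Data.List.Membership.Propositional.Properties
  using (∈-lookup; ∈-AllPairs₂; ∈-map⁻; ∈-filter⁺; ∈-allFin)
open import Function using (_∘_)
open import Relation.Nullary using (yes; no; contradiction)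
open import Relation.Binary using (Rel; DecidableEquality)
open import Relation.Binary.PropositionalEquality as ≡ using (_≡_; _≢_; refl; cong; trans; subst)

private
  variable
    A B : Set

unique-lookup-injective : ∀ {xs : List A} → Unique xs →
  ∀ i j → lookup xs i ≡ lookup xs j → i ≡ j
unique-lookup-injective (_ ∷ _) zero zero _ = refl
unique-lookup-injective (x∉ ∷ _) zero (suc j) eq = contradiction eq (All.lookup x∉ (∈-lookup j))
unique-lookup-injective (x∉ ∷ _) (suc i) zero eq = contradiction (≡.sym eq) (All.lookup x∉ (∈-lookup i))
unique-lookup-injective (_ ∷ u) (suc i) (suc j) eq = cong suc (unique-lookup-injective u i j eq)

unique-⊆⇒length≤ : ∀ {xs ys : List A} → Unique xs → xs ⊆ ys → length xs ≤ length ys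
unique-⊆⇒length≤ {xs = xs} {ys} u xs⊆ys = injective⇒≤ {f = position} position-injective
  where
  position : Fin (length xs) → Fin (length ys)
  position i = index (xs⊆ys (∈-lookup i))

  position-injective : ∀ {i j} → position i ≡ position j → i ≡ j
  position-injective {i} {j} eq = unique-lookup-injective u i j (begin
    lookup xs i            ≡⟨ lookup-index (xs⊆ys (∈-lookup i)) ⟩
    lookup ys (position i) ≡⟨ cong (lookup ys) eq ⟩
    lookup ys (position j) ≡⟨ lookup-index (xs⊆ys (∈-lookup j)) ⟨
    lookup xs j            ∎)
    where open ≡.≡-Reasoning

SameLine : Rel (A × B) _
SameLine p q = proj₁ p ≡ proj₁ q ⊎ proj₂ p ≡ proj₂ q

RookAdjacent : Rel (A × B) _
RookAdjacent p q = p ≢ q × SameLine p q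

sameLine-refl : ∀ {p : A × B} → SameLine p p
sameLine-refl = inj₁ refl

sameLine-sym : ∀ {p q : A × B} → SameLine p q → SameLine q p
sameLine-sym (inj₁ eq) = inj₁ (≡.sym eq)
sameLine-sym (inj₂ eq) = inj₂ (≡.sym eq)

sameLine-offRow : ∀ {p q : A × B} → SameLine p q → proj₁ p ≢ proj₁ q → proj₂ p ≡ proj₂ q
sameLine-offRow (inj₁ p─q) p≢q = contradiction p─q p≢q
sameLine-offRow (inj₂ p∣q) _ = p∣q

sameLine-column : ∀ {a b c : A × B} → SameLine b a → SameLine b c →
  proj₂ c ≡ proj₂ a → proj₁ c ≢ proj₁ a → proj₂ b ≡ proj₂ a
sameLine-column (inj₂ b∣a) _ _ _ = b∣a
sameLine-column (inj₁ b─a) (inj₁ b─c) _ c≢a = contradiction (trans (≡.sym b─c) b─a) c≢a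
sameLine-column (inj₁ _) (inj₂ b∣c) c∣a _ = trans b∣c c∣a

allPairs⇒sameLine : ∀ {L : List (A × B)} → AllPairs SameLine L →
  ∀ {p q} → p ∈ L → q ∈ L → SameLine p q
allPairs⇒sameLine pL p∈ q∈ with ∈-AllPairs₂ pL p∈ q∈
... | inj₁ refl = sameLine-refl
... | inj₂ (inj₁ pq) = pq
... | inj₂ (inj₂ qp) = sameLine-sym qp

allPairs-sameLine⇒row⊎column : DecidableEquality A →
  ∀ {L : List (A × B)} {a} → AllPairs SameLine L → a ∈ L →
  All (λ b → proj₁ b ≡ proj₁ a) L ⊎ All (λ b → proj₂ b ≡ proj₂ a) L
allPairs-sameLine⇒row⊎column _≟ᴬ_ {L} {a} pL a∈L with All.all? (λ b → proj₁ b ≟ᴬ proj₁ a) L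
... | yes row = inj₁ row
... | no ¬row with find (¬All⇒Any¬ (λ b → proj₁ b ≟ᴬ proj₁ a) L ¬row)
...   | c , c∈L , c∉row = inj₂ (All.tabulate λ b∈L →
          sameLine-column (line b∈L a∈L) (line b∈L c∈L) c∣a c∉row)
  where
  line = allPairs⇒sameLine pL
  c∣a = sameLine-offRow (line c∈L a∈L) c∉row

rookAdjacent-row : ∀ (u : A) {vs : List B} → Unique vs → AllPairs RookAdjacent (map (u ,_) vs)
rookAdjacent-row u vs! = AllPairsₚ.map⁺ (AllPairs.map (λ v≢w → v≢w ∘ cong proj₂ , inj₁ refl) vs!)

map-proj₁-toList : ∀ {P : A → Set} {xs} (pxs : All P xs) → map proj₁ (All.toList pxs) ≡ xs
map-proj₁-toList [] = refl
map-proj₁-toList (_ ∷ pxs) = cong (_ ∷_) (map-proj₁-toList pxs)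

module _ {n : ℕ} (G : Graph n) where

  Edge : Fin n × Fin n → Set
  Edge p = Adj G (proj₁ p) (proj₂ p)

  neighbours : Fin n → List (Fin n)
  neighbours u = filter (adj? G u) (allFin n)

  row-length≤degree : ∀ {u L} → Unique L → All Edge L → All (λ p → proj₁ p ≡ u) L →
    length L ≤ degree G u
  row-length≤degree {u} {L} L! edges row = begin
    length L             ≡⟨ length-map proj₂ L ⟨
    length (map proj₂ L) ≤⟨ unique-⊆⇒length≤ vs! vs⊆neighbours ⟩
    degree G u           ∎
    where
    open ≤-Reasoning

    L≡row : map (u ,_) (map proj₂ L) ≡ L
    L≡row = trans (≡.sym (map-∘ L)) (map-id-local (All.map (λ p─u → cong (_, _) (≡.sym p─u)) row))

    vs! : Unique (map proj₂ L)
    vs! = Uniqueₚ.map⁻ (subst Unique (≡.sym L≡row) L!)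

    vs⊆neighbours : map proj₂ L ⊆ neighbours u
    vs⊆neighbours v∈ with ∈-map⁻ proj₂ v∈
    ... | p , p∈L , refl = ∈-filter⁺ (adj? G u) (∈-allFin _)
      (subst (λ w → Adj G w (proj₂ p)) (All.lookup row p∈L) (All.lookup edges p∈L))

  column-length≤degree : ∀ {v L} → Unique L → All Edge L → All (λ p → proj₂ p ≡ v) L →
    length L ≤ degree G v
  column-length≤degree {v} {L} L! edges column = begin
    length L            ≡⟨ length-map swap L ⟨
    length (map swap L) ≤⟨ row-length≤degree (Uniqueₚ.map⁺ (cong swap) L!)
                             (Allₚ.map⁺ (All.map (sym G) edges)) (Allₚ.map⁺ column) ⟩
    degree G v          ∎
    where open ≤-Reasoning

  rookClique-length≤degree : ∀ {p L} → AllPairs RookAdjacent (p ∷ L) → All Edge (p ∷ L) →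
    length (p ∷ L) ≤ degree G (proj₁ p) ⊎ length (p ∷ L) ≤ degree G (proj₂ p)
  rookClique-length≤degree clique edges =
    Sum.map (row-length≤degree L! edges) (column-length≤degree L! edges)
      (allPairs-sameLine⇒row⊎column _≟_ (AllPairs.map proj₂ clique) (here refl))
    where L! = AllPairs.map proj₁ clique

  rookClique-length≤ : ∀ {d} → Regular G d → ∀ {L} → AllPairs RookAdjacent L → All Edge L →
    length L ≤ d
  rookClique-length≤ _ {[]} _ _ = z≤n
  rookClique-length≤ {d} regular {_ ∷ _} clique edges =
    Sum.[ bounded , bounded ] (rookClique-length≤degree clique edges)
    where
    bounded : ∀ {m u} → m ≤ degree G u → m ≤ d
    bounded {u = u} m≤ = ≤-trans m≤ (≤-reflexive (regular u))

  clique-length≤ : ∀ {d} → Regular G d → ∀ K → IsClique (HLAdj G) K → length K ≤ d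
  clique-length≤ {d} regular K (_ , clique) = begin
    length K             ≡⟨ length-map proj₁ K ⟨
    length (map proj₁ K) ≤⟨ rookClique-length≤ regular (AllPairsₚ.map⁺ clique)
                              (Allₚ.map⁺ (All.tabulate λ {a} _ → proj₂ a)) ⟩
    d                    ∎
    where open ≤-Reasoning

  star : Fin n → List (HLVertex G)
  star u = map (λ (v , uv) → (u , v) , uv) (All.toList (all-filter (adj? G u) (allFin n)))

  map-proj₁-star : ∀ u → map proj₁ (star u) ≡ map (u ,_) (neighbours u)
  map-proj₁-star u = begin
    map proj₁ (star u)                   ≡⟨ map-∘ out-edges ⟨
    map ((u ,_) ∘ proj₁) out-edges       ≡⟨ map-∘ out-edges ⟩
    map (u ,_) (map proj₁ out-edges)     ≡⟨ cong (map (u ,_)) (map-proj₁-toList _) ⟩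
    map (u ,_) (neighbours u)            ∎
    where
    open ≡.≡-Reasoning
    out-edges = All.toList (all-filter (adj? G u) (allFin n))

  length-star : ∀ u → length (star u) ≡ degree G u
  length-star u = begin
    length (star u)                    ≡⟨ length-map proj₁ (star u) ⟨
    length (map proj₁ (star u))        ≡⟨ cong length (map-proj₁-star u) ⟩
    length (map (u ,_) (neighbours u)) ≡⟨ length-map (u ,_) (neighbours u) ⟩
    degree G u                         ∎
    where open ≡.≡-Reasoning

  star-isClique : ∀ u → IsClique (HLAdj G) (star u)
  star-isClique u = AllPairs.map (λ adj → proj₁ adj ∘ cong proj₁) clique , clique
    where
    clique : AllPairs (HLAdj G) (star u)
    clique = AllPairsₚ.map⁻ (subst (AllPairs RookAdjacent) (≡.sym (map-proj₁-star u))
      (rookAdjacent-row u (Uniqueₚ.filter⁺ (adj? G u) (Uniqueₚ.allFin⁺ n))))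

mainTheorem8 : ∀ {n : ℕ} (G : Graph n) (d : ℕ) → 1 ≤ n → Regular G d →
    CliqueNumberIs (HLVertex G) (HLAdj G) d
mainTheorem8 {suc _} G d _ regular =
  (star G zero , star-isClique G zero , trans (length-star G zero) (regular zero)) ,
  clique-length≤ G regular
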